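{- Every latin square $L$ of order $n\ge1$ contains at least $3n^4+n^3-9n^2+6n$ cuboctahedra.
   Context: A latin square of order $n$ is an $n\times n$ array $L=(q_{x,y})$, $x,y\in\{0,\ldots,n-1\}$, filled with symbols from $\{0,\ldots,n-1\}$ so that every row and every column contains each symbol exactly once. A cuboctahedron in $L$ is a tuple of ordered pairs $(a^1_1,a^1_2),(a^2_1,a^2_2),(b^1_1,b^1_2),(b^2_1,b^2_2)$ of elements of $\{0,\ldots,n-1\}$ such that $q_{a^1_{j_1},a^2_{j_2}}=q_{b^1_{j_1},b^2_{j_2}}$ for all $j_1,j_2\in\{1,2\}$; cuboctahedra are counted as such tuples. -}

module Defs where

open import Data.Nat using (ℕ; zero; suc; _+_)
open import Data.Fin using (Fin; zero; suc)
open import Data.Fin.Properties using (_≟_)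
open import Data.Product using (_×_; Σ; _,_; ∃)
open import Relation.Binary.PropositionalEquality using (_≡_)
open import Relation.Nullary using (Dec; yes; no; does)
open import Relation.Nullary.Decidable using (_×-dec_)
open import Data.Bool using (if_then_else_)

Array : ℕ → Set
Array n = Fin n → Fin n → Fin n

∃! : ∀ {n} → (Fin n → Set) → Set
∃! {n} P = Σ (Fin n) λ y → P y × (∀ z → P z → z ≡ y)

IsLatinSquare : ∀ {n} → Array n → Set
IsLatinSquare {n} q =
  (∀ (x s : Fin n) → ∃! (λ y → q x y ≡ s)) ×
  (∀ (y s : Fin n) → ∃! (λ x → q x y ≡ s))

sumFin : ∀ n → (Fin n → ℕ) → ℕ
sumFin zero    f = 0
sumFin (suc n) f = f zero + sumFin n (λ i → f (suc i))

𝟙 : ∀ {P : Set} → Dec P → ℕ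
𝟙 d = if does d then 1 else 0

IsCuboctahedron : ∀ {n} → Array n →
  (a¹₁ a¹₂ a²₁ a²₂ b¹₁ b¹₂ b²₁ b²₂ : Fin n) → Set
IsCuboctahedron q a¹₁ a¹₂ a²₁ a²₂ b¹₁ b¹₂ b²₁ b²₂ =
  (q a¹₁ a²₁ ≡ q b¹₁ b²₁) × (q a¹₁ a²₂ ≡ q b¹₁ b²₂) ×
  (q a¹₂ a²₁ ≡ q b¹₂ b²₁) × (q a¹₂ a²₂ ≡ q b¹₂ b²₂)

isCuboctahedron? : ∀ {n} (q : Array n) a¹₁ a¹₂ a²₁ a²₂ b¹₁ b¹₂ b²₁ b²₂ →
  Dec (IsCuboctahedron q a¹₁ a¹₂ a²₁ a²₂ b¹₁ b¹₂ b²₁ b²₂)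
isCuboctahedron? q a¹₁ a¹₂ a²₁ a²₂ b¹₁ b¹₂ b²₁ b²₂ =
  (q a¹₁ a²₁ ≟ q b¹₁ b²₁) ×-dec (q a¹₁ a²₂ ≟ q b¹₁ b²₂) ×-dec
  (q a¹₂ a²₁ ≟ q b¹₂ b²₁) ×-dec (q a¹₂ a²₂ ≟ q b¹₂ b²₂)

-- Number of cuboctahedra (counted as 8-tuples of elements of Fin n).
numCuboctahedra : ∀ {n} → Array n → ℕ
numCuboctahedra {n} q =
  sumFin n λ a¹₁ → sumFin n λ a¹₂ → sumFin n λ a²₁ → sumFin n λ a²₂ →
  sumFin n λ b¹₁ → sumFin n λ b¹₂ → sumFin n λ b²₁ → sumFin n λ b²₂ →
  𝟙 (isCuboctahedron? q a¹₁ a¹₂ a²₁ a²₂ b¹₁ b¹₂ b²₁ b²₂)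

-- Once a¹₁, a¹₂, a²₁, a²₂ and b¹₁ are chosen, the Latin property forces b²₁, b²₂ and b¹₂, leaving a
-- single equation.  Reparametrising a²₁, a²₂, a¹₂ by the symbols s, t, u they produce, the number of
-- cuboctahedra becomes the sum over (s, t, u) of the number of pairs (x, y) with h x = h y, where
-- h = fourthCorner s t u : Fin n → Fin n.  This collision count is n² if h is constant (s = t or
-- s = u); otherwise h misses t and u, and Σ f² ≥ Σ (3f − 2[f ≠ 0]) over the fibre sizes f of h
-- gives at least n + 2 or n + 4 according as t = u or not.  These bounds sum to 3n⁴ + n³ − 9n² + 6n.
module Submission where

open import Defs
open import Data.Nat using (ℕ; zero; suc; _+_; _*_; _^_; _≤_; z≤n; s≤s)
open import Data.Nat.Properties
  using (+-*-semiring; +-identityʳ; *-identityˡ; *-identityʳ; +-mono-≤; +-monoʳ-≤;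
         *-monoˡ-≤; *-monoʳ-≤; +-monoˡ-≤; +-cancelʳ-≤; +-cancelʳ-≡; ≤-refl; ≤-trans; ≤-reflexive;
         m≤m+n; module ≤-Reasoning)
open import Data.Nat.Tactic.RingSolver using (solve-∀; solve)
open import Data.Fin using (Fin; zero; suc)
open import Data.Fin.Properties using (_≟_; suc-injective; 0≢1+n)
open import Data.Fin.Permutation using (permutation)
open import Data.List using (_∷_; [])
open import Data.Product using (_×_; _,_; proj₁; proj₂)
open import Data.Sum using (inj₁; inj₂)
open import Data.Empty using (⊥-elim)
open import Algebra.Properties.Semiring.Sum +-*-semiring
  using (sum; sum-syntax; sum-cong-≗; sum-replicate-zero; ∑-comm; ∑-distrib-+; ∑-permute;
         *-distribˡ-sum; *-distribʳ-sum)
open import Relation.Nullary using (Dec; yes; no; ¬_)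
open import Relation.Nullary.Decidable using (_×-dec_; _⊎-dec_; ¬?; dec-true; dec-false)
open import Relation.Binary.PropositionalEquality

sumFin≡sum : ∀ n {f g : Fin n → ℕ} → (∀ i → f i ≡ g i) → sumFin n f ≡ sum g
sumFin≡sum zero    f≗g = refl
sumFin≡sum (suc n) f≗g = cong₂ _+_ (f≗g zero) (sumFin≡sum n (λ i → f≗g (suc i)))

∑-const : ∀ n c → ∑[ i < n ] c ≡ n * c
∑-const zero    c = refl
∑-const (suc n) c = cong (c +_) (∑-const n c)

∑-zero : ∀ {n} {f : Fin n → ℕ} → (∀ i → f i ≡ 0) → sum f ≡ 0
∑-zero {n} f≗0 = trans (sum-cong-≗ f≗0) (sum-replicate-zero n)

∑-mono-≤ : ∀ {n} {f g : Fin n → ℕ} → (∀ i → f i ≤ g i) → sum f ≤ sum g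
∑-mono-≤ {zero}  f≤g = z≤n
∑-mono-≤ {suc n} f≤g = +-mono-≤ (f≤g zero) (∑-mono-≤ (λ i → f≤g (suc i)))

𝟙-true : ∀ {P : Set} (P? : Dec P) → P → 𝟙 P? ≡ 1
𝟙-true P? p rewrite dec-true P? p = refl

𝟙-false : ∀ {P : Set} (P? : Dec P) → ¬ P → 𝟙 P? ≡ 0
𝟙-false P? ¬p rewrite dec-false P? ¬p = refl

𝟙-×-dec⁴ : ∀ {P Q R S : Set} (P? : Dec P) (Q? : Dec Q) (R? : Dec R) (S? : Dec S) →
  𝟙 (P? ×-dec Q? ×-dec R? ×-dec S?) ≡ 𝟙 P? * (𝟙 Q? * (𝟙 R? * 𝟙 S?))
𝟙-×-dec⁴ (no _)  _       _       _       = refl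
𝟙-×-dec⁴ (yes _) (no _)  _       _       = refl
𝟙-×-dec⁴ (yes _) (yes _) (no _)  _       = refl
𝟙-×-dec⁴ (yes _) (yes _) (yes _) (no _)  = refl
𝟙-×-dec⁴ (yes _) (yes _) (yes _) (yes _) = refl

𝟙-⊎-dec : ∀ {P Q : Set} (P? : Dec P) (Q? : Dec Q) → ¬ (P × Q) → 𝟙 (P? ⊎-dec Q?) ≡ 𝟙 P? + 𝟙 Q?
𝟙-⊎-dec (yes p) (yes q) ¬p×q = ⊥-elim (¬p×q (p , q))
𝟙-⊎-dec (yes _) (no _)  _    = refl
𝟙-⊎-dec (no _)  (yes _) _    = refl
𝟙-⊎-dec (no _)  (no _)  _    = refl

𝟙-¬?+𝟙 : ∀ {P : Set} (P? : Dec P) → 𝟙 (¬? P?) + 𝟙 P? ≡ 1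
𝟙-¬?+𝟙 (yes _) = refl
𝟙-¬?+𝟙 (no _)  = refl

∑-select : ∀ {n} {P : Fin n → Set} (P? : ∀ i → Dec (P i)) {i₀ : Fin n} →
  (∀ {i} → P i → i ≡ i₀) → P i₀ → (f : Fin n → ℕ) →
  ∑[ i < n ] (𝟙 (P? i) * f i) ≡ f i₀
∑-select {suc n} P? {zero} unique p f =
  trans (cong₂ _+_ (cong (_* f zero) (𝟙-true (P? zero) p))
                   (∑-zero λ i → cong (_* f (suc i)) (𝟙-false (P? (suc i)) λ p′ → 0≢1+n (sym (unique p′)))))
        (trans (+-identityʳ _) (*-identityˡ _))
∑-select {suc n} P? {suc i₀} unique p f =
  cong₂ _+_ (cong (_* f zero) (𝟙-false (P? zero) λ p′ → 0≢1+n (unique p′)))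
            (∑-select (λ i → P? (suc i)) (λ p′ → suc-injective (unique p′)) p (λ i → f (suc i)))

∑∑-1 : ∀ n → ∑[ i < n ] ∑[ j < n ] 1 ≡ n * n
∑∑-1 n = trans (∑-const n (∑[ j < n ] 1)) (cong (n *_) (trans (∑-const n 1) (*-identityʳ n)))

∑-𝟙-≟ : ∀ {n} (a : Fin n) → ∑[ v < n ] 𝟙 (a ≟ v) ≡ 1
∑-𝟙-≟ a = trans (sum-cong-≗ (λ v → sym (*-identityʳ (𝟙 (a ≟ v)))))
                (∑-select (a ≟_) sym refl (λ _ → 1))

fibre : ∀ {m n} → (Fin m → Fin n) → Fin n → ℕ
fibre {m} h v = ∑[ x < m ] 𝟙 (h x ≟ v)

collisions : ∀ {m n} → (Fin m → Fin n) → ℕ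
collisions {m} h = ∑[ x < m ] ∑[ y < m ] 𝟙 (h x ≟ h y)

∑-fibre : ∀ {m n} (h : Fin m → Fin n) → ∑[ v < n ] fibre h v ≡ m
∑-fibre {m} {n} h = begin
  ∑[ v < n ] ∑[ x < m ] 𝟙 (h x ≟ v)  ≡⟨ ∑-comm (λ v x → 𝟙 (h x ≟ v)) ⟩
  ∑[ x < m ] ∑[ v < n ] 𝟙 (h x ≟ v)  ≡⟨ sum-cong-≗ (λ x → ∑-𝟙-≟ (h x)) ⟩
  ∑[ x < m ] 1                       ≡⟨ ∑-const m 1 ⟩
  m * 1                              ≡⟨ *-identityʳ m ⟩
  m                                  ∎
  where open ≡-Reasoning

collisions≡∑fibre² : ∀ {m n} (h : Fin m → Fin n) →
  collisions h ≡ ∑[ v < n ] (fibre h v * fibre h v)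
collisions≡∑fibre² {m} {n} h = begin
  ∑[ x < m ] ∑[ y < m ] 𝟙 (h x ≟ h y)
    ≡⟨ ∑-comm (λ x y → 𝟙 (h x ≟ h y)) ⟩
  ∑[ y < m ] fibre h (h y)
    ≡⟨ sum-cong-≗ (λ y → ∑-select (h y ≟_) sym refl (fibre h)) ⟨
  ∑[ y < m ] ∑[ v < n ] (𝟙 (h y ≟ v) * fibre h v)
    ≡⟨ ∑-comm (λ y v → 𝟙 (h y ≟ v) * fibre h v) ⟩
  ∑[ v < n ] ∑[ y < m ] (𝟙 (h y ≟ v) * fibre h v)
    ≡⟨ sum-cong-≗ (λ v → *-distribʳ-sum (fibre h v) (λ y → 𝟙 (h y ≟ v))) ⟨
  ∑[ v < n ] (fibre h v * fibre h v) ∎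
  where open ≡-Reasoning

collisions-const : ∀ {m n} {h : Fin m → Fin n} {w : Fin n} → (∀ x → h x ≡ w) → collisions h ≡ m * m
collisions-const {m} {h = h} h≗w = begin
  ∑[ x < m ] ∑[ y < m ] 𝟙 (h x ≟ h y) ≡⟨ sum-cong-≗ (λ x → sum-cong-≗ (λ y →
                                          𝟙-true (h x ≟ h y) (trans (h≗w x) (sym (h≗w y))))) ⟩
  ∑[ x < m ] ∑[ y < m ] 1             ≡⟨ ∑∑-1 m ⟩
  m * m                               ∎
  where open ≡-Reasoning

3*k≤k*k+2*a : ∀ k {a} → (k ≢ 0 → 1 ≤ a) → 3 * k ≤ k * k + 2 * a
3*k≤k*k+2*a 0 _   = z≤n
3*k≤k*k+2*a 1 1≤a = +-monoʳ-≤ 1 (*-monoʳ-≤ 2 (1≤a λ ()))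
3*k≤k*k+2*a 2 1≤a = +-monoʳ-≤ 4 (*-monoʳ-≤ 2 (1≤a λ ()))
3*k≤k*k+2*a k@(suc (suc (suc _))) _ = ≤-trans (*-monoˡ-≤ k {3} {k} (s≤s (s≤s (s≤s z≤n)))) (m≤m+n (k * k) _)

collisions-lowerBound : ∀ {m n} (h : Fin m → Fin n) (A : Fin n → ℕ) →
  (∀ v → fibre h v ≢ 0 → 1 ≤ A v) → 3 * m ≤ collisions h + 2 * sum A
collisions-lowerBound {m} {n} h A hit⇒A = begin
  3 * m                                        ≡⟨ cong (3 *_) (∑-fibre h) ⟨
  3 * ∑[ v < n ] fibre h v                     ≡⟨ *-distribˡ-sum 3 (fibre h) ⟩
  ∑[ v < n ] (3 * fibre h v)                   ≤⟨ ∑-mono-≤ (λ v → 3*k≤k*k+2*a (fibre h v) (hit⇒A v)) ⟩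
  ∑[ v < n ] (fibre h v * fibre h v + 2 * A v) ≡⟨ ∑-distrib-+ (λ v → fibre h v * fibre h v) (λ v → 2 * A v) ⟩
  ∑[ v < n ] (fibre h v * fibre h v) + ∑[ v < n ] (2 * A v)
    ≡⟨ cong₂ _+_ (collisions≡∑fibre² h) (*-distribˡ-sum 2 A) ⟨
  collisions h + 2 * sum A                     ∎
  where open ≤-Reasoning

collisions-avoiding : ∀ {n} (h : Fin n → Fin n) {Q : Fin n → Set} (Q? : ∀ v → Dec (Q v)) →
  (∀ x → ¬ Q (h x)) → n + 2 * ∑[ v < n ] 𝟙 (Q? v) ≤ collisions h
collisions-avoiding {n} h {Q} Q? avoid = +-cancelʳ-≤ (2 * a) _ _ (begin
  n + 2 * k + 2 * a     ≡⟨ cong (λ m → m + 2 * k + 2 * a) a+k≡n ⟨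
  a + k + 2 * k + 2 * a ≡⟨ rearrange a k ⟩
  3 * (a + k)           ≡⟨ cong (3 *_) a+k≡n ⟩
  3 * n                 ≤⟨ collisions-lowerBound h (λ v → 𝟙 (¬? (Q? v))) hit⇒¬Q ⟩
  collisions h + 2 * a  ∎)
  where
  open ≤-Reasoning
  a k : ℕ
  a = ∑[ v < n ] 𝟙 (¬? (Q? v))
  k = ∑[ v < n ] 𝟙 (Q? v)
  a+k≡n : a + k ≡ n
  a+k≡n = trans (sym (∑-distrib-+ (λ v → 𝟙 (¬? (Q? v))) (λ v → 𝟙 (Q? v))))
                (trans (sum-cong-≗ (λ v → 𝟙-¬?+𝟙 (Q? v))) (trans (∑-const n 1) (*-identityʳ n)))
  rearrange : ∀ a k → a + k + 2 * k + 2 * a ≡ 3 * (a + k)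
  rearrange = solve-∀
  hit⇒¬Q : ∀ v → fibre h v ≢ 0 → 1 ≤ 𝟙 (¬? (Q? v))
  hit⇒¬Q v fibre≢0 with Q? v
  ... | yes q = ⊥-elim (fibre≢0 (∑-zero λ x → 𝟙-false (h x ≟ v) λ hx≡v → avoid x (subst Q (sym hx≡v) q)))
  ... | no _  = ≤-refl

collisions-avoiding₁ : ∀ {n} (h : Fin n → Fin n) {t : Fin n} → (∀ x → t ≢ h x) → n + 2 ≤ collisions h
collisions-avoiding₁ {n} h {t} avoid =
  subst (λ k → n + 2 * k ≤ collisions h) (∑-𝟙-≟ t) (collisions-avoiding h (t ≟_) avoid)

collisions-avoiding₂ : ∀ {n} (h : Fin n → Fin n) {t u : Fin n} → t ≢ u →
  (∀ x → t ≢ h x) → (∀ x → u ≢ h x) → n + 4 ≤ collisions h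
collisions-avoiding₂ {n} h {t} {u} t≢u avoid-t avoid-u =
  subst (λ k → n + 2 * k ≤ collisions h) two
    (collisions-avoiding h (λ v → (t ≟ v) ⊎-dec (u ≟ v)) λ { x (inj₁ t≡hx) → avoid-t x t≡hx
                                                            ; x (inj₂ u≡hx) → avoid-u x u≡hx })
  where
  two : ∑[ v < n ] 𝟙 ((t ≟ v) ⊎-dec (u ≟ v)) ≡ 2
  two = begin
    ∑[ v < n ] 𝟙 ((t ≟ v) ⊎-dec (u ≟ v))
      ≡⟨ sum-cong-≗ (λ v → 𝟙-⊎-dec (t ≟ v) (u ≟ v) λ (t≡v , u≡v) → t≢u (trans t≡v (sym u≡v))) ⟩
    ∑[ v < n ] (𝟙 (t ≟ v) + 𝟙 (u ≟ v))
      ≡⟨ ∑-distrib-+ (λ v → 𝟙 (t ≟ v)) (λ v → 𝟙 (u ≟ v)) ⟩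
    ∑[ v < n ] 𝟙 (t ≟ v) + ∑[ v < n ] 𝟙 (u ≟ v)
      ≡⟨ cong₂ _+_ (∑-𝟙-≟ t) (∑-𝟙-≟ u) ⟩
    2 ∎
    where open ≡-Reasoning

∑³ : ∀ n → (Fin n → Fin n → Fin n → ℕ) → ℕ
∑³ n F = ∑[ s < n ] ∑[ t < n ] ∑[ u < n ] F s t u

∑³-cong : ∀ {n} {F G : Fin n → Fin n → Fin n → ℕ} → (∀ s t u → F s t u ≡ G s t u) → ∑³ n F ≡ ∑³ n G
∑³-cong F≗G = sum-cong-≗ λ s → sum-cong-≗ λ t → sum-cong-≗ (F≗G s t)

∑³-mono-≤ : ∀ {n} {F G : Fin n → Fin n → Fin n → ℕ} → (∀ s t u → F s t u ≤ G s t u) → ∑³ n F ≤ ∑³ n G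
∑³-mono-≤ F≤G = ∑-mono-≤ λ s → ∑-mono-≤ λ t → ∑-mono-≤ (F≤G s t)

∑³-distrib-+ : ∀ {n} (F G : Fin n → Fin n → Fin n → ℕ) →
  ∑³ n (λ s t u → F s t u + G s t u) ≡ ∑³ n F + ∑³ n G
∑³-distrib-+ {n} F G =
  trans (sum-cong-≗ λ s →
          trans (sum-cong-≗ λ t → ∑-distrib-+ (F s t) (G s t))
                (∑-distrib-+ (λ t → sum (F s t)) (λ t → sum (G s t))))
        (∑-distrib-+ (λ s → ∑[ t < n ] sum (F s t)) (λ s → ∑[ t < n ] sum (G s t)))

∑³-*ˡ : ∀ {n} c (F : Fin n → Fin n → Fin n → ℕ) → ∑³ n (λ s t u → c * F s t u) ≡ c * ∑³ n F
∑³-*ˡ {n} c F =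
  sym (trans (*-distribˡ-sum c (λ s → ∑[ t < n ] sum (F s t))) (sum-cong-≗ λ s →
         trans (*-distribˡ-sum c (λ t → sum (F s t))) (sum-cong-≗ λ t → *-distribˡ-sum c (F s t))))

∑³-affine : ∀ {n} c (F G : Fin n → Fin n → Fin n → ℕ) →
  ∑³ n (λ s t u → c * F s t u + G s t u) ≡ c * ∑³ n F + ∑³ n G
∑³-affine {n} c F G = trans (∑³-distrib-+ (λ s t u → c * F s t u) G) (cong (_+ ∑³ n G) (∑³-*ˡ c F))

∑³-const : ∀ n c → ∑³ n (λ _ _ _ → c) ≡ n * (n * (n * c))
∑³-const n c = begin
  ∑[ s < n ] ∑[ t < n ] ∑[ u < n ] c ≡⟨ ∑-const n (∑[ t < n ] ∑[ u < n ] c) ⟩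
  n * ∑[ t < n ] ∑[ u < n ] c         ≡⟨ cong (n *_) (∑-const n (∑[ u < n ] c)) ⟩
  n * (n * ∑[ u < n ] c)              ≡⟨ cong (λ m → n * (n * m)) (∑-const n c) ⟩
  n * (n * (n * c))                   ∎
  where open ≡-Reasoning

∑³-𝟙[s≡t] : ∀ n → ∑³ n (λ s t u → 𝟙 (s ≟ t)) ≡ n * n
∑³-𝟙[s≡t] n = begin
  ∑[ s < n ] ∑[ t < n ] ∑[ u < n ] 𝟙 (s ≟ t)
    ≡⟨ sum-cong-≗ (λ (s : Fin n) → sum-cong-≗ (λ t → ∑-const n (𝟙 (s ≟ t)))) ⟩
  ∑[ s < n ] ∑[ t < n ] (n * 𝟙 (s ≟ t))
    ≡⟨ sum-cong-≗ (λ (s : Fin n) → *-distribˡ-sum n (λ t → 𝟙 (s ≟ t))) ⟨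
  ∑[ s < n ] (n * ∑[ t < n ] 𝟙 (s ≟ t))
    ≡⟨ sum-cong-≗ (λ (s : Fin n) → trans (cong (n *_) (∑-𝟙-≟ s)) (*-identityʳ n)) ⟩
  ∑[ s < n ] n
    ≡⟨ ∑-const n n ⟩
  n * n ∎
  where open ≡-Reasoning

∑³-𝟙[s≡u] : ∀ n → ∑³ n (λ s t u → 𝟙 (s ≟ u)) ≡ n * n
∑³-𝟙[s≡u] n = trans (sum-cong-≗ (λ (s : Fin n) → sum-cong-≗ (λ (t : Fin n) → ∑-𝟙-≟ s))) (∑∑-1 n)

∑³-𝟙[t≡u] : ∀ n → ∑³ n (λ s t u → 𝟙 (t ≟ u)) ≡ n * n
∑³-𝟙[t≡u] n = trans (sum-cong-≗ (λ (s : Fin n) → sum-cong-≗ (λ (t : Fin n) → ∑-𝟙-≟ t))) (∑∑-1 n)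

∑³-𝟙[s≡t≡u] : ∀ n → ∑³ n (λ s t u → 𝟙 (s ≟ t) * 𝟙 (s ≟ u)) ≡ n
∑³-𝟙[s≡t≡u] n = begin
  ∑[ s < n ] ∑[ t < n ] ∑[ u < n ] (𝟙 (s ≟ t) * 𝟙 (s ≟ u))
    ≡⟨ sum-cong-≗ (λ (s : Fin n) → sum-cong-≗ (λ t → *-distribˡ-sum (𝟙 (s ≟ t)) (λ u → 𝟙 (s ≟ u)))) ⟨
  ∑[ s < n ] ∑[ t < n ] (𝟙 (s ≟ t) * ∑[ u < n ] 𝟙 (s ≟ u))
    ≡⟨ sum-cong-≗ (λ (s : Fin n) → sum-cong-≗ (λ t → trans (cong (𝟙 (s ≟ t) *_) (∑-𝟙-≟ s)) (*-identityʳ _))) ⟩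
  ∑[ s < n ] ∑[ t < n ] 𝟙 (s ≟ t)
    ≡⟨ sum-cong-≗ (∑-𝟙-≟ {n}) ⟩
  ∑[ s < n ] 1
    ≡⟨ trans (∑-const n 1) (*-identityʳ n) ⟩
  n ∎
  where open ≡-Reasoning

cornerBound : ∀ {n} → Fin n → Fin n → Fin n → ℕ
cornerBound {n} s t u with s ≟ t | s ≟ u | t ≟ u
... | yes _ | _     | _     = n * n
... | no _  | yes _ | _     = n * n
... | no _  | no _  | yes _ = n + 2
... | no _  | no _  | no _  = n + 4

-- cornerBound through the indicators of s ≡ t, s ≡ u, t ≡ u and s ≡ t ≡ u, whose triple sums are
-- n², n², n² and n; terms with negative coefficients are moved to the left.  In each case cong₂
-- first unfolds cornerBound, which the ring solver cannot see through.
cornerBound-indicators : ∀ {n} (s t u : Fin n) →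
  cornerBound s t u + ((n + 4) * 𝟙 (s ≟ t) + ((n + 4) * 𝟙 (s ≟ u) +
                       (2 * 𝟙 (t ≟ u) + n * n * (𝟙 (s ≟ t) * 𝟙 (s ≟ u)))))
  ≡ n * n * 𝟙 (s ≟ t) + (n * n * 𝟙 (s ≟ u) + ((n + 6) * (𝟙 (s ≟ t) * 𝟙 (s ≟ u)) + (n + 4)))
cornerBound-indicators {n} s t u with s ≟ t | s ≟ u | t ≟ u
... | yes _   | yes _   | yes _   = trans (cong₂ _+_ {y = n * n} refl refl) (solve (n ∷ []))
... | yes s≡t | yes s≡u | no t≢u  = ⊥-elim (t≢u (trans (sym s≡t) s≡u))
... | yes s≡t | no s≢u  | yes t≡u = ⊥-elim (s≢u (trans s≡t t≡u))
... | yes _   | no _    | no _    = trans (cong₂ _+_ {y = n * n} refl refl) (solve (n ∷ []))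
... | no s≢t  | yes s≡u | yes t≡u = ⊥-elim (s≢t (trans s≡u (sym t≡u)))
... | no _    | yes _   | no _    = trans (cong₂ _+_ {y = n * n} refl refl) (solve (n ∷ []))
... | no _    | no _    | yes _   = trans (cong₂ _+_ {y = n + 2} refl refl) (solve (n ∷ []))
... | no _    | no _    | no _    = trans (cong₂ _+_ {y = n + 4} refl refl) (solve (n ∷ []))

∑³-cornerBound : ∀ n → ∑³ n cornerBound + 9 * n ^ 2 ≡ 3 * n ^ 4 + n ^ 3 + 6 * n
∑³-cornerBound n = +-cancelʳ-≡ X _ _ (begin
  ∑³ n cornerBound + 9 * n ^ 2 + X       ≡⟨ +-comm-middle (∑³ n cornerBound) (9 * n ^ 2) X ⟩
  ∑³ n cornerBound + X + 9 * n ^ 2       ≡⟨ cong (_+ 9 * n ^ 2) ∑³cornerBound+X ⟩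
  Y + 9 * n ^ 2                          ≡⟨ polynomial n ⟩
  3 * n ^ 4 + n ^ 3 + 6 * n + X          ∎)
  where
  open ≡-Reasoning
  [s≡t] [s≡u] [t≡u] [s≡t≡u] : Fin n → Fin n → Fin n → ℕ
  [s≡t] s t u = 𝟙 (s ≟ t)
  [s≡u] s t u = 𝟙 (s ≟ u)
  [t≡u] s t u = 𝟙 (t ≟ u)
  [s≡t≡u] s t u = 𝟙 (s ≟ t) * 𝟙 (s ≟ u)
  L R : Fin n → Fin n → Fin n → ℕ
  L s t u = (n + 4) * [s≡t] s t u + ((n + 4) * [s≡u] s t u + (2 * [t≡u] s t u + n * n * [s≡t≡u] s t u))
  R s t u = n * n * [s≡t] s t u + (n * n * [s≡u] s t u + ((n + 6) * [s≡t≡u] s t u + (n + 4)))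
  X Y : ℕ
  X = (n + 4) * (n * n) + ((n + 4) * (n * n) + (2 * (n * n) + n * n * n))
  Y = n * n * (n * n) + (n * n * (n * n) + ((n + 6) * n + n * (n * (n * (n + 4)))))
  ∑³L : ∑³ n L ≡ X
  ∑³L =
    trans (∑³-affine (n + 4) [s≡t] _) (cong₂ _+_ (cong ((n + 4) *_) (∑³-𝟙[s≡t] n))
   (trans (∑³-affine (n + 4) [s≡u] _) (cong₂ _+_ (cong ((n + 4) *_) (∑³-𝟙[s≡u] n))
   (trans (∑³-affine 2 [t≡u] _) (cong₂ _+_ (cong (2 *_) (∑³-𝟙[t≡u] n))
   (trans (∑³-*ˡ (n * n) [s≡t≡u]) (cong (n * n *_) (∑³-𝟙[s≡t≡u] n))))))))
  ∑³R : ∑³ n R ≡ Y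
  ∑³R =
    trans (∑³-affine (n * n) [s≡t] _) (cong₂ _+_ (cong (n * n *_) (∑³-𝟙[s≡t] n))
   (trans (∑³-affine (n * n) [s≡u] _) (cong₂ _+_ (cong (n * n *_) (∑³-𝟙[s≡u] n))
   (trans (∑³-affine (n + 6) [s≡t≡u] _) (cong₂ _+_ (cong ((n + 6) *_) (∑³-𝟙[s≡t≡u] n))
   (∑³-const n (n + 4)))))))
  ∑³cornerBound+X : ∑³ n cornerBound + X ≡ Y
  ∑³cornerBound+X = begin
    ∑³ n cornerBound + X                        ≡⟨ cong (∑³ n cornerBound +_) ∑³L ⟨
    ∑³ n cornerBound + ∑³ n L                   ≡⟨ ∑³-distrib-+ cornerBound L ⟨
    ∑³ n (λ s t u → cornerBound s t u + L s t u) ≡⟨ ∑³-cong (cornerBound-indicators {n}) ⟩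
    ∑³ n R                                      ≡⟨ ∑³R ⟩
    Y                                           ∎
  +-comm-middle : ∀ a b c → a + b + c ≡ a + c + b
  +-comm-middle a b c = solve (a ∷ b ∷ c ∷ [])
  polynomial : ∀ k → k * k * (k * k) + (k * k * (k * k) + ((k + 6) * k + k * (k * (k * (k + 4)))))
                       + 9 * (k * (k * 1))
                   ≡ 3 * (k * (k * (k * (k * 1)))) + k * (k * (k * 1)) + 6 * k
                       + ((k + 4) * (k * k) + ((k + 4) * (k * k) + (2 * (k * k) + k * k * k)))
  polynomial k = solve (k ∷ [])

∑-∑³-comm : ∀ {m n} (F : Fin m → Fin n → Fin n → Fin n → ℕ) →
  ∑[ x < m ] ∑³ n (F x) ≡ ∑³ n (λ s t u → ∑[ x < m ] F x s t u)
∑-∑³-comm {m} {n} F =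
  trans (∑-comm (λ x s → ∑[ t < n ] ∑[ u < n ] F x s t u)) (sum-cong-≗ λ s →
    trans (∑-comm (λ x t → ∑[ u < n ] F x s t u)) (sum-cong-≗ λ t → ∑-comm (λ x u → F x s t u)))

numCuboctahedra≡sum : ∀ {n} (q : Array n) →
  numCuboctahedra q ≡ ∑[ a¹₁ < n ] ∑[ a¹₂ < n ] ∑[ a²₁ < n ] ∑[ a²₂ < n ]
                      ∑[ b¹₁ < n ] ∑[ b¹₂ < n ] ∑[ b²₁ < n ] ∑[ b²₂ < n ]
                        𝟙 (isCuboctahedron? q a¹₁ a¹₂ a²₁ a²₂ b¹₁ b¹₂ b²₁ b²₂)
numCuboctahedra≡sum {n} q =
  S λ a¹₁ → S λ a¹₂ → S λ a²₁ → S λ a²₂ → S λ b¹₁ → S λ b¹₂ → S λ b²₁ → S λ b²₂ → refl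
  where
  S : ∀ {f g : Fin n → ℕ} → (∀ i → f i ≡ g i) → sumFin n f ≡ sum g
  S = sumFin≡sum n

module LatinSquare {n} {q : Array n} (latin : IsLatinSquare q) where

  column : Fin n → Fin n → Fin n
  column x s = proj₁ (proj₁ latin x s)

  q-column : ∀ x s → q x (column x s) ≡ s
  q-column x s = proj₁ (proj₂ (proj₁ latin x s))

  column-unique : ∀ {x s y} → q x y ≡ s → y ≡ column x s
  column-unique {x} {s} {y} = proj₂ (proj₂ (proj₁ latin x s)) y

  row : Fin n → Fin n → Fin n
  row y s = proj₁ (proj₂ latin y s)

  q-row : ∀ y s → q (row y s) y ≡ s
  q-row y s = proj₁ (proj₂ (proj₂ latin y s))

  row-unique : ∀ {y s x} → q x y ≡ s → x ≡ row y s
  row-unique {y} {s} {x} = proj₂ (proj₂ (proj₂ latin y s)) x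

  ∑-column : ∀ x (F : Fin n → ℕ) → ∑[ y < n ] F y ≡ ∑[ s < n ] F (column x s)
  ∑-column x F = ∑-permute F (permutation (column x) (q x) (λ y → sym (column-unique refl)) (q-column x))

  ∑-row : ∀ y (F : Fin n → ℕ) → ∑[ x < n ] F x ≡ ∑[ s < n ] F (row y s)
  ∑-row y F = ∑-permute F (permutation (row y) (λ x → q x y) (λ x → sym (row-unique refl)) (q-row y))

  ∑-select-column : ∀ x s (F : Fin n → ℕ) → ∑[ y < n ] (𝟙 (s ≟ q x y) * F y) ≡ F (column x s)
  ∑-select-column x s = ∑-select (λ y → s ≟ q x y) (λ s≡qxy → column-unique (sym s≡qxy)) (sym (q-column x s))

  ∑-select-row : ∀ y s (F : Fin n → ℕ) → ∑[ x < n ] (𝟙 (s ≟ q x y) * F x) ≡ F (row y s)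
  ∑-select-row y s = ∑-select (λ x → s ≟ q x y) (λ s≡qxy → row-unique (sym s≡qxy)) (sym (q-row y s))

  -- The cells (x, column x s), (x, column x t) and (row (column x s) u, column x s) carry the
  -- symbols s, t and u; fourthCorner s t u x is the symbol in the fourth corner of their rectangle.
  fourthCorner : Fin n → Fin n → Fin n → Fin n → Fin n
  fourthCorner s t u x = q (row (column x s) u) (column x t)

  fourthCorner-s≡t : ∀ {s t} u → s ≡ t → ∀ x → fourthCorner s t u x ≡ u
  fourthCorner-s≡t {s} u refl x = q-row (column x s) u

  fourthCorner-s≡u : ∀ {s} t {u} → s ≡ u → ∀ x → fourthCorner s t u x ≡ t
  fourthCorner-s≡u {s} t refl x =
    trans (cong (λ r → q r (column x t)) (sym (row-unique (q-column x s)))) (q-column x t)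

  t≢fourthCorner : ∀ {s t u} → s ≢ u → ∀ x → t ≢ fourthCorner s t u x
  t≢fourthCorner {s} {t} {u} s≢u x t≡corner = s≢u (begin
    s                                   ≡⟨ q-column x s ⟨
    q x (column x s)                    ≡⟨ cong (λ r → q r (column x s)) corner-row≡x ⟨
    q (row (column x s) u) (column x s) ≡⟨ q-row (column x s) u ⟩
    u                                   ∎)
    where
    open ≡-Reasoning
    corner-row≡x : row (column x s) u ≡ x
    corner-row≡x = trans (row-unique (sym t≡corner)) (sym (row-unique (q-column x t)))

  u≢fourthCorner : ∀ {s t u} → s ≢ t → ∀ x → u ≢ fourthCorner s t u x
  u≢fourthCorner {s} {t} {u} s≢t x u≡corner = s≢t (begin
    s                ≡⟨ q-column x s ⟨
    q x (column x s) ≡⟨ cong (q x) (trans (column-unique (q-row (column x s) u))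
                                          (sym (column-unique (sym u≡corner)))) ⟩
    q x (column x t) ≡⟨ q-column x t ⟩
    t                ∎)
    where open ≡-Reasoning

  cornerBound≤collisions : ∀ s t u → cornerBound s t u ≤ collisions (fourthCorner s t u)
  cornerBound≤collisions s t u with s ≟ t | s ≟ u | t ≟ u
  ... | yes s≡t | _       | _       = ≤-reflexive (sym (collisions-const (fourthCorner-s≡t u s≡t)))
  ... | no _    | yes s≡u | _       = ≤-reflexive (sym (collisions-const (fourthCorner-s≡u t s≡u)))
  ... | no _    | no s≢u  | yes refl = collisions-avoiding₁ (fourthCorner s t t) (t≢fourthCorner s≢u)
  ... | no s≢t  | no s≢u  | no t≢u  =
    collisions-avoiding₂ (fourthCorner s t u) t≢u (t≢fourthCorner s≢u) (u≢fourthCorner s≢t)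

  -- Given a¹₁, a¹₂, a²₁, a²₂ and b¹₁, the first two conditions force b²₁ and b²₂ and the third
  -- then forces b¹₂; only the fourth condition remains.
  cuboctahedra-completing : ∀ a¹₁ a¹₂ a²₁ a²₂ b¹₁ →
    ∑[ b¹₂ < n ] ∑[ b²₁ < n ] ∑[ b²₂ < n ] 𝟙 (isCuboctahedron? q a¹₁ a¹₂ a²₁ a²₂ b¹₁ b¹₂ b²₁ b²₂)
      ≡ 𝟙 (q a¹₂ a²₂ ≟ fourthCorner (q a¹₁ a²₁) (q a¹₁ a²₂) (q a¹₂ a²₁) b¹₁)
  cuboctahedra-completing a¹₁ a¹₂ a²₁ a²₂ b¹₁ = begin
    ∑[ b¹₂ < n ] ∑[ b²₁ < n ] ∑[ b²₂ < n ] 𝟙 (isCuboctahedron? q a¹₁ a¹₂ a²₁ a²₂ b¹₁ b¹₂ b²₁ b²₂)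
      ≡⟨ ∑³-cong (λ b¹₂ b²₁ b²₂ →
           𝟙-×-dec⁴ (s ≟ q b¹₁ b²₁) (t ≟ q b¹₁ b²₂) (u ≟ q b¹₂ b²₁) (v ≟ q b¹₂ b²₂)) ⟩
    ∑[ b¹₂ < n ] ∑[ b²₁ < n ] ∑[ b²₂ < n ] E b¹₂ b²₁ b²₂
      ≡⟨ sum-cong-≗ (λ b¹₂ → ∑-comm (E b¹₂)) ⟩
    ∑[ b¹₂ < n ] ∑[ b²₂ < n ] ∑[ b²₁ < n ] E b¹₂ b²₁ b²₂
      ≡⟨ sum-cong-≗ (λ b¹₂ → sum-cong-≗ (λ b²₂ →
           ∑-select-column b¹₁ s (λ b²₁ → 𝟙 (t ≟ q b¹₁ b²₂) * (𝟙 (u ≟ q b¹₂ b²₁) * 𝟙 (v ≟ q b¹₂ b²₂))))) ⟩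
    ∑[ b¹₂ < n ] ∑[ b²₂ < n ] (𝟙 (t ≟ q b¹₁ b²₂) * (𝟙 (u ≟ q b¹₂ (column b¹₁ s)) * 𝟙 (v ≟ q b¹₂ b²₂)))
      ≡⟨ sum-cong-≗ (λ b¹₂ →
           ∑-select-column b¹₁ t (λ b²₂ → 𝟙 (u ≟ q b¹₂ (column b¹₁ s)) * 𝟙 (v ≟ q b¹₂ b²₂))) ⟩
    ∑[ b¹₂ < n ] (𝟙 (u ≟ q b¹₂ (column b¹₁ s)) * 𝟙 (v ≟ q b¹₂ (column b¹₁ t)))
      ≡⟨ ∑-select-row (column b¹₁ s) u (λ b¹₂ → 𝟙 (v ≟ q b¹₂ (column b¹₁ t))) ⟩
    𝟙 (v ≟ fourthCorner s t u b¹₁) ∎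
    where
    open ≡-Reasoning
    s t u v : Fin n
    s = q a¹₁ a²₁
    t = q a¹₁ a²₂
    u = q a¹₂ a²₁
    v = q a¹₂ a²₂
    E : Fin n → Fin n → Fin n → ℕ
    E b¹₂ b²₁ b²₂ = 𝟙 (s ≟ q b¹₁ b²₁) * (𝟙 (t ≟ q b¹₁ b²₂) * (𝟙 (u ≟ q b¹₂ b²₁) * 𝟙 (v ≟ q b¹₂ b²₂)))

  -- Substitute a²₁ = column x s, a²₂ = column x t and a¹₂ = row (column x s) u.
  cuboctahedra-by-symbols : ∀ x →
    ∑[ a¹₂ < n ] ∑[ a²₁ < n ] ∑[ a²₂ < n ] ∑[ y < n ]
      𝟙 (q a¹₂ a²₂ ≟ fourthCorner (q x a²₁) (q x a²₂) (q a¹₂ a²₁) y)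
    ≡ ∑³ n (λ s t u → ∑[ y < n ] 𝟙 (fourthCorner s t u x ≟ fourthCorner s t u y))
  cuboctahedra-by-symbols x = begin
    ∑[ a¹₂ < n ] ∑[ a²₁ < n ] ∑[ a²₂ < n ] G a¹₂ a²₁ a²₂
      ≡⟨ ∑-comm (λ a¹₂ a²₁ → ∑[ a²₂ < n ] G a¹₂ a²₁ a²₂) ⟩
    ∑[ a²₁ < n ] ∑[ a¹₂ < n ] ∑[ a²₂ < n ] G a¹₂ a²₁ a²₂
      ≡⟨ ∑-column x (λ a²₁ → ∑[ a¹₂ < n ] ∑[ a²₂ < n ] G a¹₂ a²₁ a²₂) ⟩
    ∑[ s < n ] ∑[ a¹₂ < n ] ∑[ a²₂ < n ] G a¹₂ (column x s) a²₂
      ≡⟨ sum-cong-≗ (λ s → ∑-comm (λ a¹₂ a²₂ → G a¹₂ (column x s) a²₂)) ⟩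
    ∑[ s < n ] ∑[ a²₂ < n ] ∑[ a¹₂ < n ] G a¹₂ (column x s) a²₂
      ≡⟨ sum-cong-≗ (λ s → ∑-column x (λ a²₂ → ∑[ a¹₂ < n ] G a¹₂ (column x s) a²₂)) ⟩
    ∑[ s < n ] ∑[ t < n ] ∑[ a¹₂ < n ] G a¹₂ (column x s) (column x t)
      ≡⟨ sum-cong-≗ (λ s → sum-cong-≗ (λ t → ∑-row (column x s) (λ a¹₂ → G a¹₂ (column x s) (column x t)))) ⟩
    ∑³ n (λ s t u → G (row (column x s) u) (column x s) (column x t))
      ≡⟨ ∑³-cong G-corner ⟩
    ∑³ n (λ s t u → ∑[ y < n ] 𝟙 (fourthCorner s t u x ≟ fourthCorner s t u y)) ∎
    where
    open ≡-Reasoning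
    G : Fin n → Fin n → Fin n → ℕ
    G a¹₂ a²₁ a²₂ = ∑[ y < n ] 𝟙 (q a¹₂ a²₂ ≟ fourthCorner (q x a²₁) (q x a²₂) (q a¹₂ a²₁) y)
    G-corner : ∀ s t u → G (row (column x s) u) (column x s) (column x t)
                       ≡ ∑[ y < n ] 𝟙 (fourthCorner s t u x ≟ fourthCorner s t u y)
    G-corner s t u rewrite q-column x s | q-column x t | q-row (column x s) u = refl

  numCuboctahedra≡∑³collisions : numCuboctahedra q ≡ ∑³ n (λ s t u → collisions (fourthCorner s t u))
  numCuboctahedra≡∑³collisions = begin
    numCuboctahedra q
      ≡⟨ numCuboctahedra≡sum q ⟩
    ∑[ a¹₁ < n ] ∑[ a¹₂ < n ] ∑[ a²₁ < n ] ∑[ a²₂ < n ]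
    ∑[ b¹₁ < n ] ∑[ b¹₂ < n ] ∑[ b²₁ < n ] ∑[ b²₂ < n ]
      𝟙 (isCuboctahedron? q a¹₁ a¹₂ a²₁ a²₂ b¹₁ b¹₂ b²₁ b²₂)
      ≡⟨ sum-cong-≗ (λ a¹₁ → ∑³-cong (λ a¹₂ a²₁ a²₂ → sum-cong-≗ (λ b¹₁ →
           cuboctahedra-completing a¹₁ a¹₂ a²₁ a²₂ b¹₁))) ⟩
    ∑[ x < n ] ∑[ a¹₂ < n ] ∑[ a²₁ < n ] ∑[ a²₂ < n ] ∑[ y < n ]
      𝟙 (q a¹₂ a²₂ ≟ fourthCorner (q x a²₁) (q x a²₂) (q a¹₂ a²₁) y)
      ≡⟨ sum-cong-≗ cuboctahedra-by-symbols ⟩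
    ∑[ x < n ] ∑³ n (λ s t u → ∑[ y < n ] 𝟙 (fourthCorner s t u x ≟ fourthCorner s t u y))
      ≡⟨ ∑-∑³-comm (λ x s t u → ∑[ y < n ] 𝟙 (fourthCorner s t u x ≟ fourthCorner s t u y)) ⟩
    ∑³ n (λ s t u → collisions (fourthCorner s t u)) ∎
    where open ≡-Reasoning

theorem4 : (n : ℕ) → 1 ≤ n → (q : Array n) → IsLatinSquare q →
    3 * n ^ 4 + n ^ 3 + 6 * n ≤ numCuboctahedra q + 9 * n ^ 2
theorem4 n _ q latin = begin
  3 * n ^ 4 + n ^ 3 + 6 * n
    ≡⟨ ∑³-cornerBound n ⟨
  ∑³ n cornerBound + 9 * n ^ 2
    ≤⟨ +-monoˡ-≤ (9 * n ^ 2) (∑³-mono-≤ cornerBound≤collisions) ⟩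
  ∑³ n (λ s t u → collisions (fourthCorner s t u)) + 9 * n ^ 2
    ≡⟨ cong (_+ 9 * n ^ 2) numCuboctahedra≡∑³collisions ⟨
  numCuboctahedra q + 9 * n ^ 2 ∎
  where
  open ≤-Reasoning
  open LatinSquare latin
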